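{- Let $g,h$ be integers with $3\le g\le h$. Let $G^*=G(2,g,h)$ be the graph with vertex set $U\cup W$, where $U=\{u_1,\dots,u_{h-1}\}$ and $W=\{w_2,\dots,w_h\}$ are disjoint, whose edge set consists of all edges $u_iw_j$ with $1\le i<j\le h$, together with, in case $g\ge 4$ and writing $\gamma=g-3$, all edges $u_iw_j$ with $1\le i-j\le\gamma$, $2\le i\le h-1$, $2\le j\le h-2$. Then $\chi(G^*)=2$, $\Gamma(G^*)=g$ and $\psi(G^*)=h$.
   Context: A complete $k$-coloring of a graph is a proper coloring with exactly $k$ colors in which any two color classes are joined by at least one edge; $\psi$ (achromatic number) is the maximum such $k$, $\chi$ is the chromatic number. A Grundy coloring is a proper coloring $\varphi:V\to\{1,\dots,k\}$ in which every vertex $v$ has a neighbor of color $i$ for every $1\le i<\varphi(v)$; the Grundy number $\Gamma$ is the maximum $k$ for which such a coloring exists. -}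

module Defs where

open import Data.Nat using (ℕ; zero; suc; _+_; _∸_; _≤_; _<_)
open import Data.Fin using (Fin; toℕ)
open import Data.Sum using (_⊎_; inj₁; inj₂)
open import Data.Product using (Σ; ∃; ∃-syntax; _×_; _,_)
open import Data.Empty using (⊥)
open import Relation.Binary.PropositionalEquality using (_≡_; _≢_)

-- A graph is given by a vertex type V and an adjacency relation E.
-- (The graph G* below is a finite simple graph: E is symmetric and irreflexive.)

-- Colourings use colours Fin k = {0,…,k-1} (colour c corresponds to c+1 in the paper).

Proper : {V : Set} → (V → V → Set) → {k : ℕ} → (V → Fin k) → Set
Proper {V} E φ = ∀ (x y : V) → E x y → φ x ≢ φ y

UsesAll : {V : Set} → {k : ℕ} → (V → Fin k) → Set
UsesAll {V} {k} φ = ∀ (c : Fin k) → ∃[ v ] (φ v ≡ c)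

IsComplete : {V : Set} → (V → V → Set) → {k : ℕ} → (V → Fin k) → Set
IsComplete {V} E {k} φ =
  Proper E φ × UsesAll φ ×
  (∀ (c d : Fin k) → c ≢ d → ∃[ x ] ∃[ y ] (E x y × φ x ≡ c × φ y ≡ d))

IsGrundy : {V : Set} → (V → V → Set) → {k : ℕ} → (V → Fin k) → Set
IsGrundy {V} E {k} φ =
  Proper E φ ×
  (∀ (v : V) (c : Fin k) → toℕ c < toℕ (φ v) → ∃[ w ] (E v w × φ w ≡ c))

IsChromaticNumber : {V : Set} → (V → V → Set) → ℕ → Set
IsChromaticNumber {V} E k =
  (Σ (V → Fin k) λ φ → Proper E φ) ×
  (∀ (m : ℕ) (φ : V → Fin m) → Proper E φ → k ≤ m)

IsGrundyNumber : {V : Set} → (V → V → Set) → ℕ → Set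
IsGrundyNumber {V} E k =
  (Σ (V → Fin k) λ φ → IsGrundy E φ × UsesAll φ) ×
  (∀ (m : ℕ) (φ : V → Fin m) → IsGrundy E φ → UsesAll φ → m ≤ k)

IsAchromaticNumber : {V : Set} → (V → V → Set) → ℕ → Set
IsAchromaticNumber {V} E k =
  (Σ (V → Fin k) λ φ → IsComplete E φ) ×
  (∀ (m : ℕ) (φ : V → Fin m) → IsComplete E φ → m ≤ k)

-- The graph G(2,g,h).
-- Vertices: inj₁ a = u_i with i = toℕ a + 1  (i = 1 … h-1)
--           inj₂ b = w_j with j = toℕ b + 2  (j = 2 … h)
GV : ℕ → Set
GV h = Fin (h ∸ 1) ⊎ Fin (h ∸ 1)

UWEdge : ℕ → ℕ → ℕ → ℕ → Set
UWEdge g h i j =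
  (1 ≤ i × i < j × j ≤ h) ⊎
  (4 ≤ g × (1 ≤ i ∸ j × i ∸ j ≤ g ∸ 3) × (2 ≤ i × i ≤ h ∸ 1) × (2 ≤ j × j ≤ h ∸ 2))

GE : (g h : ℕ) → GV h → GV h → Set
GE g h (inj₁ a) (inj₁ a') = ⊥
GE g h (inj₁ a) (inj₂ b)  = UWEdge g h (suc (toℕ a)) (suc (suc (toℕ b)))
GE g h (inj₂ b) (inj₁ a)  = UWEdge g h (suc (toℕ a)) (suc (suc (toℕ b)))
GE g h (inj₂ b) (inj₂ b') = ⊥

module Submission where

-- Write g = γ + 3 and h = k + 3.  Renumbering u_i as a = i - 1 and w_j as
-- b = j - 2, G* becomes a bipartite graph on two copies of Fin (k + 2) which
-- is a "γ-staircase": both sides are independent, u_a ~ w_b whenever a ≤ b,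
-- and u_a ~ w_b only if a ≤ b + 1 + γ.  Everything is proved for staircases.
--
--  * χ = 2: colour by side; an edge forces two colours.
--  * ψ ≤ h: in a complete colouring at most one class lies inside W, so
--    choosing a u-vertex in every other class injects colours into 1 + |U|.
--  * Γ ≤ γ + 3: in a Grundy colouring at most one class lies inside W and at
--    most one inside U; a class meeting both sides is tagged by the index of
--    its leftmost u-vertex modulo γ + 1.  These indices are pairwise at
--    distance ≤ γ (via the Grundy neighbours and the two staircase
--    conditions), so the tags are distinct.
--  * The lower bounds are explicit colourings; they use in addition that
--    u_a ≁ w_{a-1} and the "steps" u_a ~ w_b for b + 2 ≤ a ≤ γ + 1.
-- Finally G* is checked to satisfy all staircase conditions.

open import Defs
open import Data.Nat using (ℕ; zero; suc; _+_; _∸_; _*_; _%_; _/_; _≤_; _<_;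
  z≤n; s≤s; s≤s⁻¹; _≤?_; >-nonZero)
open import Data.Nat.Properties
open import Data.Nat.DivMod using (m≡m%n+[m/n]*n; m%n<n)
open import Data.Nat.Divisibility using (_∣_; divides; ∣⇒≤)
open import Data.Fin using (Fin; toℕ; fromℕ<; inject₁; inject)
import Data.Fin.Properties as Fin
open import Data.Sum using (_⊎_; inj₁; inj₂)
open import Data.Product using (Σ; ∃; ∃-syntax; _×_; _,_; proj₁; proj₂)
open import Data.Empty using (⊥; ⊥-elim)
open import Data.Unit using (⊤; tt)
open import Function using (_∘_)
open import Relation.Nullary using (¬_; Dec; yes; no; ¬?; contradiction)
open import Relation.Nullary.Decidable using (decidable-stable)
open import Relation.Binary using (tri<; tri≈; tri>)
open import Relation.Binary.PropositionalEquality
  using (_≡_; _≢_; refl; sym; trans; cong; cong₂; subst; subst₂; module ≡-Reasoning)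

-- If 0 < y - x ≤ γ then x and y have different residues modulo γ + 1:
-- a common residue would make y - x a positive multiple of γ + 1.
residues-differ : ∀ γ {x y} → x < y → y ≤ x + γ → x % suc γ ≢ y % suc γ
residues-differ γ {x} {y} x<y y≤x+γ same =
  1+n≰n (≤-trans (∣⇒≤ {{>-nonZero (m<n⇒0<n∸m x<y)}} multiple) (m≤n+o⇒m∸n≤o y x y≤x+γ))
  where
  open ≡-Reasoning
  n : ℕ
  n = suc γ
  multiple : n ∣ y ∸ x
  multiple = divides (y / n ∸ x / n) (begin
    y ∸ x                                      ≡⟨ cong₂ _∸_ (m≡m%n+[m/n]*n y n) (m≡m%n+[m/n]*n x n) ⟩
    (y % n + y / n * n) ∸ (x % n + x / n * n)  ≡⟨ cong (λ r → (r + y / n * n) ∸ (x % n + x / n * n)) (sym same) ⟩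
    (x % n + y / n * n) ∸ (x % n + x / n * n)  ≡⟨ [m+n]∸[m+o]≡n∸o (x % n) _ _ ⟩
    y / n * n ∸ x / n * n                      ≡⟨ sym (*-distribʳ-∸ n (y / n) (x / n)) ⟩
    (y / n ∸ x / n) * n                        ∎)

close-residues-differ : ∀ γ {x y} → x ≢ y → x ≤ y + γ → y ≤ x + γ → x % suc γ ≢ y % suc γ
close-residues-differ γ {x} {y} x≢y x≤y+γ y≤x+γ with <-cmp x y
... | tri< x<y _ _ = residues-differ γ x<y y≤x+γ
... | tri≈ _ x≡y _ = contradiction x≡y x≢y
... | tri> _ _ y<x = residues-differ γ y<x x≤y+γ ∘ sym

least-witness : ∀ {n} {P : Fin n → Set} → (∀ i → Dec (P i)) → ∃ P →
                Σ (Fin n) λ i → P i × (∀ j → P j → toℕ i ≤ toℕ j)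
least-witness {n} {P} P? (i , pi)
  with Fin.¬∀⟶∃¬-smallest n (¬_ ∘ P) (¬? ∘ P?) (λ nowhere → nowhere i pi)
... | least , ¬¬P-least , earlier-fail =
  least , decidable-stable (P? least) ¬¬P-least ,
  λ j pj → ≮⇒≥ (λ j<least → earlier-fail (fromℕ< j<least) (subst P (sym (inject-fromℕ< j<least)) pj))
  where
  inject-fromℕ< : ∀ {j} (j<least : toℕ j < toℕ least) → inject (fromℕ< j<least) ≡ j
  inject-fromℕ< j<least =
    Fin.toℕ-injective (trans (Fin.toℕ-inject (fromℕ< j<least)) (Fin.toℕ-fromℕ< j<least))

edge⇒two-colours : ∀ {V : Set} {E : V → V → Set} {x y : V} → E x y →
                   ∀ m (φ : V → Fin m) → Proper E φ → 2 ≤ m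
edge⇒two-colours {x = x} {y} e m φ proper = distinct⇒2≤ (proper x y e)
  where
  distinct⇒2≤ : ∀ {m} {i j : Fin m} → i ≢ j → 2 ≤ m
  distinct⇒2≤ {suc zero} {Fin.zero} {Fin.zero} i≢j = contradiction refl i≢j
  distinct⇒2≤ {suc (suc m)} _ = s≤s (s≤s z≤n)

side : ∀ {X Y : Set} → X ⊎ Y → Fin 2
side (inj₁ _) = Fin.zero
side (inj₂ _) = Fin.suc Fin.zero

side-proper : ∀ {X Y : Set} {E : X ⊎ Y → X ⊎ Y → Set} →
              (∀ x x' → ¬ E (inj₁ x) (inj₁ x')) → (∀ y y' → ¬ E (inj₂ y) (inj₂ y')) →
              Proper E side
side-proper indepX indepY (inj₁ x) (inj₁ x') e _ = indepX x x' e
side-proper indepX indepY (inj₂ y) (inj₂ y') e _ = indepY y y' e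

Independent : {V : Set} → (V → V → Set) → (V → Set) → Set
Independent E T = ∀ x y → T x → T y → ¬ E x y

ClassWithin : {V : Set} {m : ℕ} → (V → Set) → (V → Fin m) → Fin m → Set
ClassWithin T φ c = ∀ v → φ v ≡ c → T v

-- In a complete colouring any two classes are joined by an edge, so at most
-- one class lies inside an independent set.
complete-within-unique : ∀ {V : Set} {E : V → V → Set} {m} {φ : V → Fin m} (T : V → Set) →
  Independent E T → IsComplete E φ → ∀ c d → ClassWithin T φ c → ClassWithin T φ d → c ≡ d
complete-within-unique T indep (_ , _ , joined) c d c⊆T d⊆T with c Fin.≟ d
... | yes c≡d = c≡d
... | no c≢d with joined c d c≢d
...   | x , y , e , φx≡c , φy≡d = ⊥-elim (indep x y (c⊆T x φx≡c) (d⊆T y φy≡d) e)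

-- In a Grundy colouring a vertex of the larger of two colours has a neighbour
-- of the smaller one, so the two classes cannot both lie in an independent set.
grundy-not-both-within : ∀ {V : Set} {E : V → V → Set} {m} {φ : V → Fin m} (T : V → Set) →
  Independent E T → IsGrundy E φ → UsesAll φ →
  ∀ {c d} → toℕ c < toℕ d → ClassWithin T φ c → ClassWithin T φ d → ⊥
grundy-not-both-within T indep (_ , sees) uses {c} {d} c<d c⊆T d⊆T with uses d
... | v , φv≡d with sees v c (subst (λ e → toℕ c < toℕ e) (sym φv≡d) c<d)
...   | w , e , φw≡c = indep v w (d⊆T v φv≡d) (c⊆T w φw≡c) e

grundy-within-unique : ∀ {V : Set} {E : V → V → Set} {m} {φ : V → Fin m} (T : V → Set) →
  Independent E T → IsGrundy E φ → UsesAll φ →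
  ∀ c d → ClassWithin T φ c → ClassWithin T φ d → c ≡ d
grundy-within-unique T indep grundy uses c d c⊆T d⊆T with Fin.<-cmp c d
... | tri< c<d _ _ = ⊥-elim (grundy-not-both-within T indep grundy uses c<d c⊆T d⊆T)
... | tri≈ _ c≡d _ = c≡d
... | tri> _ _ d<c = ⊥-elim (grundy-not-both-within T indep grundy uses d<c d⊆T c⊆T)

IsLeft IsRight : {X Y : Set} → X ⊎ Y → Set
IsLeft (inj₁ _) = ⊤
IsLeft (inj₂ _) = ⊥
IsRight (inj₁ _) = ⊥
IsRight (inj₂ _) = ⊤

HasLeft : {X Y : Set} {m : ℕ} → (X ⊎ Y → Fin m) → Fin m → Set
HasLeft φ c = ∃ λ x → φ (inj₁ x) ≡ c

HasRight : {X Y : Set} {m : ℕ} → (X ⊎ Y → Fin m) → Fin m → Set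
HasRight φ c = ∃ λ y → φ (inj₂ y) ≡ c

left-independent : ∀ {X Y : Set} {E : X ⊎ Y → X ⊎ Y → Set} →
                   (∀ x x' → ¬ E (inj₁ x) (inj₁ x')) → Independent E IsLeft
left-independent indepX (inj₁ x) (inj₁ x') _ _ = indepX x x'

right-independent : ∀ {X Y : Set} {E : X ⊎ Y → X ⊎ Y → Set} →
                    (∀ y y' → ¬ E (inj₂ y) (inj₂ y')) → Independent E IsRight
right-independent indepY (inj₂ y) (inj₂ y') _ _ = indepY y y'

no-left⇒within-right : ∀ {X Y : Set} {m} {φ : X ⊎ Y → Fin m} {c} →
                       ¬ HasLeft φ c → ClassWithin IsRight φ c
no-left⇒within-right none (inj₁ x) φx≡c = none (x , φx≡c)
no-left⇒within-right none (inj₂ _) _ = tt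

no-right⇒within-left : ∀ {X Y : Set} {m} {φ : X ⊎ Y → Fin m} {c} →
                       ¬ HasRight φ c → ClassWithin IsLeft φ c
no-right⇒within-left none (inj₁ _) _ = tt
no-right⇒within-left none (inj₂ y) φy≡c = none (y , φy≡c)

-- A complete colouring of a graph on Fin p ⊎ Y with Y independent uses at
-- most p + 1 colours: the class lying inside Y (if any) is sent to 0 and
-- every other class to 1 + (some left vertex of it), injectively.
complete-colours≤ : ∀ {p} {Y : Set} {E : Fin p ⊎ Y → Fin p ⊎ Y → Set} →
  (∀ y y' → ¬ E (inj₂ y) (inj₂ y')) → ∀ m (φ : Fin p ⊎ Y → Fin m) → IsComplete E φ → m ≤ suc p
complete-colours≤ {p} indepY m φ complete =
  Fin.injective⇒≤ {f = λ c → representative c (has-left? c)}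
                  (λ {c} {d} → representative-injective c d _ _)
  where
  has-left? : ∀ c → Dec (HasLeft φ c)
  has-left? c = Fin.any? (λ x → φ (inj₁ x) Fin.≟ c)

  representative : ∀ c → Dec (HasLeft φ c) → Fin (suc p)
  representative c (yes (x , _)) = Fin.suc x
  representative c (no _) = Fin.zero

  representative-injective : ∀ c d (lc : Dec (HasLeft φ c)) (ld : Dec (HasLeft φ d)) →
                             representative c lc ≡ representative d ld → c ≡ d
  representative-injective c d (yes (x , φx≡c)) (yes (_ , φx≡d)) refl = trans (sym φx≡c) φx≡d
  representative-injective c d (no ¬lc) (no ¬ld) _ =
    complete-within-unique IsRight (right-independent indepY) complete c d
      (no-left⇒within-right ¬lc) (no-left⇒within-right ¬ld)

-- Staircases

record Staircase (n γ : ℕ) (E : Fin n ⊎ Fin n → Fin n ⊎ Fin n → Set) : Set where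
  field
    symmetric : ∀ {x y} → E x y → E y x
    independentU : ∀ a a' → ¬ E (inj₁ a) (inj₁ a')
    independentW : ∀ b b' → ¬ E (inj₂ b) (inj₂ b')
    upward : ∀ a b → toℕ a ≤ toℕ b → E (inj₁ a) (inj₂ b)
    narrow : ∀ a b → E (inj₁ a) (inj₂ b) → toℕ a ≤ suc (toℕ b + γ)

module _ {n γ : ℕ} {E : Fin n ⊎ Fin n → Fin n ⊎ Fin n → Set} (S : Staircase n γ E) where
  open Staircase S

  staircase-ψ≤ : ∀ m (φ : Fin n ⊎ Fin n → Fin m) → IsComplete E φ → m ≤ suc n
  staircase-ψ≤ = complete-colours≤ independentW

  shared-colour-order : ∀ {m} {φ : Fin n ⊎ Fin n → Fin m} → Proper E φ →
                        ∀ a b → φ (inj₁ a) ≡ φ (inj₂ b) → toℕ b < toℕ a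
  shared-colour-order proper a b same = ≰⇒> (λ a≤b → proper _ _ (upward a b a≤b) same)

  module GrundyBound {m} (φ : Fin n ⊎ Fin n → Fin m) (grundy : IsGrundy E φ) (uses : UsesAll φ) where
    proper : Proper E φ
    proper = proj₁ grundy

    sees : ∀ v c → toℕ c < toℕ (φ v) → ∃[ w ] (E v w × φ w ≡ c)
    sees = proj₂ grundy

    -- u_a of colour above that of u_a' has a neighbour w_b coloured like u_a',
    -- and b < a' since they share a colour; hence a ≤ b + 1 + γ ≤ a' + γ.
    reach-from-left : ∀ a a' → toℕ (φ (inj₁ a')) < toℕ (φ (inj₁ a)) → toℕ a ≤ toℕ a' + γ
    reach-from-left a a' lt with sees (inj₁ a) (φ (inj₁ a')) lt
    ... | inj₁ x , e , _ = contradiction e (independentU a x)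
    ... | inj₂ b , e , φb≡φa' =
      ≤-trans (narrow a b e) (+-monoˡ-≤ γ (shared-colour-order proper a' b (sym φb≡φa')))

    -- Dually, w_b coloured like u_a has a neighbour u_x coloured like u_a';
    -- if u_a' is the leftmost vertex of its colour, a' ≤ x ≤ b + 1 + γ ≤ a + γ.
    reach-from-right : ∀ a b a' → φ (inj₂ b) ≡ φ (inj₁ a) →
      toℕ (φ (inj₁ a')) < toℕ (φ (inj₁ a)) →
      (∀ x → φ (inj₁ x) ≡ φ (inj₁ a') → toℕ a' ≤ toℕ x) → toℕ a' ≤ toℕ a + γ
    reach-from-right a b a' φb≡φa lt leftmost
      with sees (inj₂ b) (φ (inj₁ a')) (subst (λ c → toℕ (φ (inj₁ a')) < toℕ c) (sym φb≡φa) lt)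
    ... | inj₂ y , e , _ = contradiction e (independentW b y)
    ... | inj₁ x , e , φx≡φa' =
      ≤-trans (leftmost x φx≡φa')
        (≤-trans (narrow x b (symmetric e))
                 (+-monoˡ-≤ γ (shared-colour-order proper a b (sym φb≡φa))))

    leftmost : ∀ c → HasLeft φ c →
               Σ (Fin n) λ a → φ (inj₁ a) ≡ c × (∀ x → φ (inj₁ x) ≡ c → toℕ a ≤ toℕ x)
    leftmost c = least-witness (λ a → φ (inj₁ a) Fin.≟ c)

    -- Colours d < c, with c also met on the right, whose leftmost u-vertices
    -- are u_ac and u_ad: these lie at distance ≤ γ, hence differ mod γ + 1.
    ordered-separated : ∀ {c d} ac ad → φ (inj₁ ac) ≡ c → HasRight φ c → φ (inj₁ ad) ≡ d →
      (∀ x → φ (inj₁ x) ≡ d → toℕ ad ≤ toℕ x) → toℕ d < toℕ c →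
      toℕ ac % suc γ ≢ toℕ ad % suc γ
    ordered-separated {c} {d} ac ad φac≡c (b , φb≡c) φad≡d leftmost-d d<c =
      close-residues-differ γ ac≢ad (reach-from-left ac ad lt)
        (reach-from-right ac b ad (trans φb≡c (sym φac≡c)) lt (λ x e → leftmost-d x (trans e φad≡d)))
      where
      lt : toℕ (φ (inj₁ ad)) < toℕ (φ (inj₁ ac))
      lt = subst₂ (λ d′ c′ → toℕ d′ < toℕ c′) (sym φad≡d) (sym φac≡c) d<c
      ac≢ad : toℕ ac ≢ toℕ ad
      ac≢ad e = Fin.<-irrefl (trans (sym φad≡d) (trans (cong (φ ∘ inj₁) (sym (Fin.toℕ-injective e))) φac≡c)) d<c

    residue : ∀ c → HasLeft φ c → ℕ
    residue c hc = toℕ (proj₁ (leftmost c hc)) % suc γ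

    residues-separated : ∀ c d (hc : HasLeft φ c) → HasRight φ c → (hd : HasLeft φ d) →
                         toℕ d < toℕ c → residue c hc ≢ residue d hd
    residues-separated c d hc rc hd =
      ordered-separated (proj₁ (leftmost c hc)) (proj₁ (leftmost d hd))
        (proj₁ (proj₂ (leftmost c hc))) rc (proj₁ (proj₂ (leftmost d hd))) (proj₂ (proj₂ (leftmost d hd)))

    mixed-separated : ∀ c d (hc : HasLeft φ c) → HasRight φ c → (hd : HasLeft φ d) → HasRight φ d →
                      residue c hc ≡ residue d hd → c ≡ d
    mixed-separated c d hc rc hd rd same with Fin.<-cmp c d
    ... | tri< c<d _ _ = contradiction (sym same) (residues-separated d c hd rd hc c<d)
    ... | tri≈ _ c≡d _ = c≡d
    ... | tri> _ _ d<c = contradiction same (residues-separated c d hc rc hd d<c)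

    -- 0: class inside W;  1: class inside U;  2 + residue: class meeting both.
    tag : ∀ c → Dec (HasLeft φ c) → Dec (HasRight φ c) → Fin (3 + γ)
    tag c (no _) _ = Fin.zero
    tag c (yes _) (no _) = Fin.suc Fin.zero
    tag c (yes hc) (yes _) = Fin.suc (Fin.suc (fromℕ< (m%n<n (toℕ (proj₁ (leftmost c hc))) (suc γ))))

    tag-injective : ∀ c d lc rc ld rd → tag c lc rc ≡ tag d ld rd → c ≡ d
    tag-injective c d (no ¬lc) _ (no ¬ld) _ _ =
      grundy-within-unique IsRight (right-independent independentW) grundy uses c d
        (no-left⇒within-right ¬lc) (no-left⇒within-right ¬ld)
    tag-injective c d (yes _) (no ¬rc) (yes _) (no ¬rd) _ =
      grundy-within-unique IsLeft (left-independent independentU) grundy uses c d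
        (no-right⇒within-left ¬rc) (no-right⇒within-left ¬rd)
    tag-injective c d (yes hc) (yes rc) (yes hd) (yes rd) same =
      mixed-separated c d hc rc hd rd
        (Fin.fromℕ<-injective _ _ _ _ (Fin.suc-injective (Fin.suc-injective same)))
    tag-injective c d (no _) _ (yes _) (no _) ()
    tag-injective c d (no _) _ (yes _) (yes _) ()
    tag-injective c d (yes _) (no _) (no _) _ ()
    tag-injective c d (yes _) (no _) (yes _) (yes _) ()
    tag-injective c d (yes _) (yes _) (no _) _ ()
    tag-injective c d (yes _) (yes _) (yes _) (no _) ()

    bound : m ≤ 3 + γ
    bound = Fin.injective⇒≤ {f = λ c → tag c (has-left? c) (has-right? c)}
                            (λ {c} {d} → tag-injective c d _ _ _ _)
      where
      has-left? : ∀ c → Dec (HasLeft φ c)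
      has-left? c = Fin.any? (λ a → φ (inj₁ a) Fin.≟ c)
      has-right? : ∀ c → Dec (HasRight φ c)
      has-right? c = Fin.any? (λ b → φ (inj₂ b) Fin.≟ c)

  staircase-Γ≤ : ∀ m (φ : Fin n ⊎ Fin n → Fin m) → IsGrundy E φ → UsesAll φ → m ≤ 3 + γ
  staircase-Γ≤ m φ grundy uses = GrundyBound.bound φ grundy uses

-- Lower bounds for nonempty staircases

fromℕ-grundy : ∀ {V : Set} {E : V → V → Set} k (col : V → ℕ) → (∀ v → col v < k) →
  (∀ x y → E x y → col x ≢ col y) →
  (∀ v c → c < col v → ∃[ w ] (E v w × col w ≡ c)) →
  (∀ c → c < k → ∃[ v ] (col v ≡ c)) →
  Σ (V → Fin k) λ φ → IsGrundy E φ × UsesAll φ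
fromℕ-grundy {V} {E} k col col<k proper sees covers = φ , (φ-proper , φ-sees) , φ-covers
  where
  φ : V → Fin k
  φ v = fromℕ< (col<k v)

  toℕ-φ : ∀ v → toℕ (φ v) ≡ col v
  toℕ-φ v = Fin.toℕ-fromℕ< (col<k v)

  φ-proper : Proper E φ
  φ-proper x y e same = proper x y e (trans (sym (toℕ-φ x)) (trans (cong toℕ same) (toℕ-φ y)))

  φ-sees : ∀ v c → toℕ c < toℕ (φ v) → ∃[ w ] (E v w × φ w ≡ c)
  φ-sees v c lt with sees v (toℕ c) (subst (toℕ c <_) (toℕ-φ v) lt)
  ... | w , e , col-w = w , e , Fin.toℕ-injective (trans (toℕ-φ w) col-w)

  φ-covers : UsesAll φ
  φ-covers c with covers (toℕ c) (Fin.toℕ<n c)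
  ... | v , col-v = v , Fin.toℕ-injective (trans (toℕ-φ v) col-v)

left-colour : ℕ → ℕ → ℕ
left-colour γ zero = suc γ
left-colour γ (suc a) with a ≤? γ
... | yes _ = a
... | no _ = 0

right-colour : ℕ → ℕ → ℕ
right-colour γ b with b ≤? γ
... | yes _ = b
... | no _ = suc (suc γ)

left-colour-low : ∀ {γ a} → a ≤ γ → left-colour γ (suc a) ≡ a
left-colour-low {γ} {a} a≤γ with a ≤? γ
... | yes _ = refl
... | no a≰γ = contradiction a≤γ a≰γ

right-colour-low : ∀ {γ b} → b ≤ γ → right-colour γ b ≡ b
right-colour-low {γ} {b} b≤γ with b ≤? γ
... | yes _ = refl
... | no b≰γ = contradiction b≤γ b≰γ

right-colour-high : ∀ {γ b} → ¬ b ≤ γ → right-colour γ b ≡ suc (suc γ)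
right-colour-high {γ} {b} b≰γ with b ≤? γ
... | yes b≤γ = contradiction b≤γ b≰γ
... | no _ = refl

left-colour< : ∀ γ a → left-colour γ a < 3 + γ
left-colour< γ zero = s≤s (n≤1+n (suc γ))
left-colour< γ (suc a) with a ≤? γ
... | yes a≤γ = s≤s (≤-trans a≤γ (m≤n+m γ 2))
... | no _ = s≤s z≤n

right-colour< : ∀ γ b → right-colour γ b < 3 + γ
right-colour< γ b with b ≤? γ
... | yes b≤γ = s≤s (≤-trans b≤γ (m≤n+m γ 2))
... | no _ = ≤-refl

module _ {n γ : ℕ} {E : Fin (suc n) ⊎ Fin (suc n) → Fin (suc n) ⊎ Fin (suc n) → Set}
         (S : Staircase (suc n) γ E) where
  open Staircase S

  staircase-χ : IsChromaticNumber E 2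
  staircase-χ = (side , side-proper independentU independentW) ,
                λ m φ → edge⇒two-colours (upward Fin.zero Fin.zero z≤n) m φ

  -- The remaining lower bounds use that u_{b+1} ≁ w_b (in the paper's
  -- numbering: u_i ≁ w_i).
  module _ (off-diagonal : ∀ a b → E (inj₁ a) (inj₂ b) → toℕ a ≢ suc (toℕ b)) where

    -- u_a ↦ a and w_b ↦ b + 1: u_i and w_i get the same colour.
    diagonal : Fin (suc n) ⊎ Fin (suc n) → Fin (2 + n)
    diagonal (inj₁ a) = inject₁ a
    diagonal (inj₂ b) = Fin.suc b

    diagonal-proper : Proper E diagonal
    diagonal-proper (inj₁ a) (inj₁ a') e = contradiction e (independentU a a')
    diagonal-proper (inj₂ b) (inj₂ b') e = contradiction e (independentW b b')
    diagonal-proper (inj₁ a) (inj₂ b) e same =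
      off-diagonal a b e (trans (sym (Fin.toℕ-inject₁ a)) (cong toℕ same))
    diagonal-proper (inj₂ b) (inj₁ a) e same = diagonal-proper (inj₁ a) (inj₂ b) (symmetric e) (sym same)

    -- Colours c < d are joined by an edge u_c w_{d-1}, present since c ≤ d - 1.
    diagonal-joined : ∀ c d → toℕ c < toℕ d →
                      ∃[ a ] ∃[ b ] (E (inj₁ a) (inj₂ b) × inject₁ a ≡ c × Fin.suc b ≡ d)
    diagonal-joined c (Fin.suc b) (s≤s c≤b) =
      a , b , upward a b (subst (_≤ toℕ b) (sym a≡c) c≤b) ,
      Fin.toℕ-injective (trans (Fin.toℕ-inject₁ a) a≡c) , refl
      where
      a : Fin (suc n)
      a = fromℕ< (≤-<-trans c≤b (Fin.toℕ<n b))
      a≡c : toℕ a ≡ toℕ c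
      a≡c = Fin.toℕ-fromℕ< _

    diagonal-complete : IsComplete E diagonal
    diagonal-complete = diagonal-proper , uses , joined
      where
      uses : UsesAll diagonal
      uses Fin.zero = inj₁ Fin.zero , refl
      uses (Fin.suc b) = inj₂ b , refl
      joined : ∀ c d → c ≢ d → ∃[ x ] ∃[ y ] (E x y × diagonal x ≡ c × diagonal y ≡ d)
      joined c d c≢d with Fin.<-cmp c d
      ... | tri≈ _ c≡d _ = contradiction c≡d c≢d
      ... | tri< c<d _ _ with diagonal-joined c d c<d
      ...   | a , b , e , a↦c , b↦d = inj₁ a , inj₂ b , e , a↦c , b↦d
      joined c d c≢d | tri> _ _ d<c with diagonal-joined d c d<c
      ...   | a , b , e , a↦d , b↦c = inj₂ b , inj₁ a , symmetric e , b↦c , a↦d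

    staircase-ψ : IsAchromaticNumber E (2 + n)
    staircase-ψ = (diagonal , diagonal-complete) , staircase-ψ≤ S

    -- The Grundy colouring further needs the steps u_a ~ w_b for
    -- b + 2 ≤ a ≤ γ + 1, and room for γ + 2 vertices on each side.
    module _ (steps : ∀ a b → suc (toℕ b) < toℕ a → toℕ a ≤ suc γ → E (inj₁ a) (inj₂ b))
             (room : γ < n) where

      colour : Fin (suc n) ⊎ Fin (suc n) → ℕ
      colour (inj₁ a) = left-colour γ (toℕ a)
      colour (inj₂ b) = right-colour γ (toℕ b)

      colour-bounded : ∀ v → colour v < 3 + γ
      colour-bounded (inj₁ a) = left-colour< γ (toℕ a)
      colour-bounded (inj₂ b) = right-colour< γ (toℕ b)

      colours-differ : ∀ a b → E (inj₁ a) (inj₂ b) → left-colour γ (toℕ a) ≢ right-colour γ (toℕ b)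
      colours-differ a b e with toℕ a in a≡i
      ... | zero with toℕ b ≤? γ
      ...   | yes b≤γ = λ same → 1+n≰n (subst (_≤ γ) (sym same) b≤γ)
      ...   | no _ = λ same → 1+n≰n (≤-reflexive (sym same))
      colours-differ a b e | suc i with i ≤? γ | toℕ b ≤? γ
      ... | yes _ | yes _ = λ same → off-diagonal a b e (trans a≡i (cong suc same))
      ... | yes i≤γ | no _ = λ same → 1+n≰n (≤-trans (n≤1+n (suc γ)) (subst (_≤ γ) same i≤γ))
      ... | no i≰γ | yes _ =
        λ same → i≰γ (s≤s⁻¹ (subst₂ (λ x y → x ≤ suc (y + γ)) a≡i (sym same) (narrow a b e)))
      ... | no _ | no _ = λ ()

      colour-proper : ∀ x y → E x y → colour x ≢ colour y
      colour-proper (inj₁ a) (inj₁ a') e = contradiction e (independentU a a')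
      colour-proper (inj₂ b) (inj₂ b') e = contradiction e (independentW b b')
      colour-proper (inj₁ a) (inj₂ b) e = colours-differ a b e
      colour-proper (inj₂ b) (inj₁ a) e = colours-differ a b (symmetric e) ∘ sym

      right-neighbour : ∀ a j → j ≤ γ → (∀ b → toℕ b ≡ j → E (inj₁ a) (inj₂ b)) →
                        ∃[ w ] (E (inj₁ a) w × colour w ≡ j)
      right-neighbour a j j≤γ edge =
        inj₂ b , edge b b≡j , trans (cong (right-colour γ) b≡j) (right-colour-low j≤γ)
        where
        b : Fin (suc n)
        b = fromℕ< (s≤s (≤-trans j≤γ (<⇒≤ room)))
        b≡j : toℕ b ≡ j
        b≡j = Fin.toℕ-fromℕ< _

      left-neighbour : ∀ b i c → i ≤ toℕ b → left-colour γ i ≡ c → ∃[ w ] (E (inj₂ b) w × colour w ≡ c)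
      left-neighbour b i c i≤b i↦c =
        inj₁ a , symmetric (upward a b (subst (_≤ toℕ b) (sym a≡i) i≤b)) ,
        trans (cong (left-colour γ) a≡i) i↦c
        where
        a : Fin (suc n)
        a = fromℕ< (≤-<-trans i≤b (Fin.toℕ<n b))
        a≡i : toℕ a ≡ i
        a≡i = Fin.toℕ-fromℕ< _

      -- u_0 sees w_0, …, w_γ; u_{i+1} (i ≤ γ) sees w_0, …, w_{i-1} through the steps.
      left-sees : ∀ a c → c < colour (inj₁ a) → ∃[ w ] (E (inj₁ a) w × colour w ≡ c)
      left-sees a c lt with toℕ a in a≡i
      ... | zero = right-neighbour a c (s≤s⁻¹ lt) (λ b _ → upward a b (subst (_≤ toℕ b) (sym a≡i) z≤n))
      ... | suc i with i ≤? γ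
      ...   | yes i≤γ = right-neighbour a c (≤-trans (<⇒≤ lt) i≤γ) λ b b≡c →
                steps a b (subst₂ _<_ (cong suc (sym b≡c)) (sym a≡i) (s≤s lt))
                          (subst (_≤ suc γ) (sym a≡i) (s≤s i≤γ))
      ...   | no _ = contradiction lt λ ()

      -- w_b (b ≤ γ) sees u_1, …, u_b; w_b (b > γ) sees u_0, …, u_{γ+1}.
      right-sees : ∀ b c → c < colour (inj₂ b) → ∃[ w ] (E (inj₂ b) w × colour w ≡ c)
      right-sees b c lt with toℕ b ≤? γ
      ... | yes b≤γ = left-neighbour b (suc c) c lt (left-colour-low (≤-trans (<⇒≤ lt) b≤γ))
      ... | no b≰γ with c ≟ suc γ
      ...   | yes c≡γ+1 = left-neighbour b 0 c z≤n (sym c≡γ+1)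
      ...   | no c≢γ+1 = left-neighbour b (suc c) c (≤-trans (s≤s c≤γ) (≰⇒> b≰γ)) (left-colour-low c≤γ)
        where
        c≤γ : c ≤ γ
        c≤γ = s≤s⁻¹ (≤∧≢⇒< (s≤s⁻¹ lt) c≢γ+1)

      colour-sees : ∀ v c → c < colour v → ∃[ w ] (E v w × colour w ≡ c)
      colour-sees (inj₁ a) = left-sees a
      colour-sees (inj₂ b) = right-sees b

      right-vertex : ∀ j → j ≤ n → ∃[ v ] (colour v ≡ right-colour γ j)
      right-vertex j j≤n = inj₂ (fromℕ< (s≤s j≤n)) , cong (right-colour γ) (Fin.toℕ-fromℕ< (s≤s j≤n))

      -- Colours 0…γ occur on w_0…w_γ, γ + 1 on u_0 and γ + 2 on w_{γ+1}.
      colour-covers : ∀ c → c < 3 + γ → ∃[ v ] (colour v ≡ c)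
      colour-covers c c<γ+3 with <-cmp c (suc γ)
      ... | tri< c<γ+1 _ _ with right-vertex c (≤-trans (s≤s⁻¹ c<γ+1) (<⇒≤ room))
      ...   | v , v↦ = v , trans v↦ (right-colour-low (s≤s⁻¹ c<γ+1))
      colour-covers c c<γ+3 | tri≈ _ c≡γ+1 _ = inj₁ Fin.zero , sym c≡γ+1
      colour-covers c c<γ+3 | tri> _ _ c>γ+1 with right-vertex (suc γ) room
      ...   | v , v↦ = v , trans v↦ (trans (right-colour-high 1+n≰n) (≤-antisym c>γ+1 (s≤s⁻¹ c<γ+3)))

      staircase-Γ : IsGrundyNumber E (3 + γ)
      staircase-Γ =
        fromℕ-grundy (3 + γ) colour colour-bounded colour-proper colour-sees colour-covers ,
        staircase-Γ≤ S

-- The graph G(2,g,h)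

uwedge-narrow : ∀ {g h i j} → UWEdge g h i j → i ≤ j + (g ∸ 3)
uwedge-narrow {j = j} (inj₁ (_ , i<j , _)) = ≤-trans (<⇒≤ i<j) (m≤m+n j _)
uwedge-narrow {i = i} {j} (inj₂ (_ , (_ , i∸j≤γ) , _)) = ≤-trans (m≤n+m∸n i j) (+-monoʳ-≤ j i∸j≤γ)

uwedge-irreflexive : ∀ {g h i j} → UWEdge g h i j → i ≢ j
uwedge-irreflexive (inj₁ (_ , i<j , _)) i≡j = <-irrefl i≡j i<j
uwedge-irreflexive {i = i} (inj₂ (_ , (1≤i∸j , _) , _)) refl =
  contradiction (subst (1 ≤_) (n∸n≡0 i) 1≤i∸j) λ ()

uwedge-step : ∀ {γ k} → γ ≤ k → ∀ a b → suc b < a → a ≤ suc γ →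
              UWEdge (3 + γ) (3 + k) (suc a) (suc (suc b))
uwedge-step {γ} γ≤k a b b+1<a a≤γ+1 =
  inj₂ (s≤s (s≤s (s≤s (≤-trans (s≤s z≤n) b+1≤γ))) ,
        (m<n⇒0<n∸m b+1<a , m≤n+o⇒m∸n≤o a (suc b) (≤-trans a≤γ+1 (s≤s (m≤n+m γ b)))) ,
        (s≤s (≤-trans (s≤s z≤n) b+1<a) , s≤s (≤-trans a≤γ+1 (s≤s γ≤k))) ,
        (s≤s (s≤s z≤n) , s≤s (≤-trans b+1≤γ γ≤k)))
  where
  b+1≤γ : suc b ≤ γ
  b+1≤γ = s≤s⁻¹ (≤-trans b+1<a a≤γ+1)

G*-staircase : ∀ γ k → Staircase (suc (suc k)) γ (GE (3 + γ) (3 + k))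
Staircase.symmetric (G*-staircase γ k) {inj₁ _} {inj₁ _} ()
Staircase.symmetric (G*-staircase γ k) {inj₁ _} {inj₂ _} e = e
Staircase.symmetric (G*-staircase γ k) {inj₂ _} {inj₁ _} e = e
Staircase.symmetric (G*-staircase γ k) {inj₂ _} {inj₂ _} ()
Staircase.independentU (G*-staircase γ k) _ _ ()
Staircase.independentW (G*-staircase γ k) _ _ ()
Staircase.upward (G*-staircase γ k) a b a≤b = inj₁ (s≤s z≤n , s≤s (s≤s a≤b) , s≤s (Fin.toℕ<n b))
Staircase.narrow (G*-staircase γ k) a b e = s≤s⁻¹ (uwedge-narrow {3 + γ} {3 + k} e)

proposition1 : (g h : ℕ) → 3 ≤ g → g ≤ h →
    IsChromaticNumber (GE g h) 2 × IsGrundyNumber (GE g h) g × IsAchromaticNumber (GE g h) h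
proposition1 (suc (suc (suc γ))) (suc (suc (suc k))) (s≤s (s≤s (s≤s z≤n))) (s≤s (s≤s (s≤s γ≤k))) =
  staircase-χ S ,
  staircase-Γ S off-diagonal (λ a b → uwedge-step γ≤k (toℕ a) (toℕ b)) (s≤s γ≤k) ,
  staircase-ψ S off-diagonal
  where
  S : Staircase (suc (suc k)) γ (GE (3 + γ) (3 + k))
  S = G*-staircase γ k
  off-diagonal : ∀ a b → GE (3 + γ) (3 + k) (inj₁ a) (inj₂ b) → toℕ a ≢ suc (toℕ b)
  off-diagonal a b e = uwedge-irreflexive {3 + γ} {3 + k} e ∘ cong suc
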